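{- Let $k$ be a positive integer and let $n$ be an integer with $k^2+1\le n\le k^2+k$. Let $\delta(n)=\min\{r+s\mid r,s\in\mathbb N_0,\ r\le s,\ rs=n\}$. Then: (i) $\delta(n)\ge 2k+1$. (ii) $\delta(n)=2k+1$ if and only if $n=(k^2+k)-(l^2+l)$ for some $l\in\mathbb N_0$ with $l^2+l\le k-1$.
   Context: $\mathbb N_0$ denotes the set of non-negative integers. -}

module Defs where

open import Data.Nat using (ℕ; _+_; _*_; _≤_)
open import Data.Product using (Σ; _×_; ∃-syntax)
open import Relation.Binary.PropositionalEquality using (_≡_)

InDeltaSet : ℕ → ℕ → Set
InDeltaSet n m = ∃[ r ] ∃[ s ] (r ≤ s × r * s ≡ n × m ≡ r + s)

IsDelta : ℕ → ℕ → Set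
IsDelta n d = InDeltaSet n d × (∀ m → InDeltaSet n m → d ≤ m)

-- Write pronic m = m * m + m. By AM-GM, 4rs ≤ (r + s)², so a factorisation n = rs with
-- n > k² has r + s ≥ 2k + 1. A factorisation with r ≤ s and r + s = 2k + 1 is exactly
-- r = k - l, s = k + l + 1 for some l ≤ k, and (k - l)(k + l + 1) = pronic k - pronic l.
-- The bound n > k² then forces pronic l < k. Since 2k + 1 is a lower bound, it is the
-- minimum exactly when it is attained.
module Submission where

open import Defs
open import Data.Nat using (ℕ; suc; pred; _+_; _*_; _∸_; _≤_; _<_; _≤?_)
open import Data.Nat.Properties
open import Data.Nat.Tactic.RingSolver using (solve-∀)
open import Data.Product using (_×_; _,_; ∃-syntax)
open import Data.Sum using (inj₁; inj₂)
open import Function.Bundles using (_⇔_; mk⇔)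
open import Function.Properties.Equivalence using () renaming (trans to ⇔-trans)
open import Relation.Binary.PropositionalEquality
  using (_≡_; refl; sym; cong; subst; subst₂; module ≡-Reasoning)
open import Relation.Nullary using (yes; no; contradiction)

pronic : ℕ → ℕ
pronic m = m * m + m

m≤n⇒4*[m*n]≤[m+n]² : ∀ {m n} → m ≤ n → 4 * (m * n) ≤ (m + n) * (m + n)
m≤n⇒4*[m*n]≤[m+n]² {m} m≤n with m≤n⇒∃[o]m+o≡n m≤n
... | t , refl = subst (4 * (m * (m + t)) ≤_) (identity m t) (m≤m+n _ (t * t))
  where
  identity : ∀ m t → 4 * (m * (m + t)) + t * t ≡ (m + (m + t)) * (m + (m + t))
  identity = solve-∀

4*[m*n]≤[m+n]² : ∀ m n → 4 * (m * n) ≤ (m + n) * (m + n)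
4*[m*n]≤[m+n]² m n with ≤-total m n
... | inj₁ m≤n = m≤n⇒4*[m*n]≤[m+n]² m≤n
... | inj₂ n≤m = subst₂ _≤_ (cong (4 *_) (*-comm n m)) (cong (λ x → x * x) (+-comm n m))
                   (m≤n⇒4*[m*n]≤[m+n]² n≤m)

m+n≤2k⇒m*n≤k*k : ∀ m n k → m + n ≤ 2 * k → m * n ≤ k * k
m+n≤2k⇒m*n≤k*k m n k m+n≤2k = *-cancelˡ-≤ 4 (begin
  4 * (m * n)        ≤⟨ 4*[m*n]≤[m+n]² m n ⟩
  (m + n) * (m + n)  ≤⟨ *-mono-≤ m+n≤2k m+n≤2k ⟩
  2 * k * (2 * k)    ≡⟨ square-double k ⟩
  4 * (k * k)        ∎)
  where
  open ≤-Reasoning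
  square-double : ∀ k → 2 * k * (2 * k) ≡ 4 * (k * k)
  square-double = solve-∀

k*k<n⇒m∈Δ[n]⇒2k<m : ∀ {n m} k → k * k < n → InDeltaSet n m → 2 * k < m
k*k<n⇒m∈Δ[n]⇒2k<m k k*k<r*s (r , s , _ , refl , refl) =
  ≰⇒> λ r+s≤2k → <⇒≱ k*k<r*s (m+n≤2k⇒m*n≤k*k r s k r+s≤2k)

IsDelta-≡⇔attained : ∀ {n d b} → IsDelta n d → (∀ m → InDeltaSet n m → b ≤ m) →
                     (d ≡ b) ⇔ InDeltaSet n b
IsDelta-≡⇔attained (d∈ , d-minimal) b-lower =
  mk⇔ (λ { refl → d∈ }) (λ b∈ → ≤-antisym (d-minimal _ b∈) (b-lower _ d∈))

r*[r+1+2l]+pronic[l]≡pronic[r+l] : ∀ r l → r * (r + suc (2 * l)) + pronic l ≡ pronic (r + l)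
r*[r+1+2l]+pronic[l]≡pronic[r+l] = identity
  where
  identity : ∀ r l → r * (r + suc (2 * l)) + (l * l + l) ≡ (r + l) * (r + l) + (r + l)
  identity = solve-∀

r+l≡k⇒1+2k≡r+[r+1+2l] : ∀ r l {k} → r + l ≡ k → suc (2 * k) ≡ r + (r + suc (2 * l))
r+l≡k⇒1+2k≡r+[r+1+2l] r l refl = identity r l
  where
  identity : ∀ r l → suc (2 * (r + l)) ≡ r + (r + suc (2 * l))
  identity = solve-∀

m≤n⇒m+n≡1+2k⇒m≤k : ∀ {m n k} → m ≤ n → m + n ≡ suc (2 * k) → m ≤ k
m≤n⇒m+n≡1+2k⇒m≤k {m} {n} {k} m≤n m+n≡1+2k with m ≤? k
... | yes m≤k = m≤k
... | no m≰k = contradiction (begin-strict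
  suc (2 * k)    <⟨ ≤-reflexive (sym (identity k)) ⟩
  suc k + suc k  ≤⟨ +-mono-≤ k<m (≤-trans k<m m≤n) ⟩
  m + n          ≡⟨ m+n≡1+2k ⟩
  suc (2 * k)    ∎) (<-irrefl refl)
  where
  open ≤-Reasoning
  k<m = ≰⇒> m≰k
  identity : ∀ k → suc k + suc k ≡ suc (suc (2 * k))
  identity = solve-∀

1+2k∈Δ[n]⇔pronic-gap : ∀ n k →
  InDeltaSet n (suc (2 * k)) ⇔ (∃[ l ] (l ≤ k × n + pronic l ≡ pronic k))
1+2k∈Δ[n]⇔pronic-gap n k = mk⇔ to from
  where
  open ≡-Reasoning

  to : InDeltaSet n (suc (2 * k)) → ∃[ l ] (l ≤ k × n + pronic l ≡ pronic k)
  to (r , s , r≤s , refl , 1+2k≡r+s) = k ∸ r , m∸n≤m k r , gap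
    where
    r+l≡k : r + (k ∸ r) ≡ k
    r+l≡k = m+[n∸m]≡n (m≤n⇒m+n≡1+2k⇒m≤k r≤s (sym 1+2k≡r+s))
    s≡r+1+2l : s ≡ r + suc (2 * (k ∸ r))
    s≡r+1+2l = +-cancelˡ-≡ r _ _ (begin
      r + s                          ≡⟨ sym 1+2k≡r+s ⟩
      suc (2 * k)                    ≡⟨ r+l≡k⇒1+2k≡r+[r+1+2l] r (k ∸ r) r+l≡k ⟩
      r + (r + suc (2 * (k ∸ r)))    ∎)
    gap : r * s + pronic (k ∸ r) ≡ pronic k
    gap = begin
      r * s + pronic (k ∸ r)                          ≡⟨ cong (λ x → r * x + pronic (k ∸ r)) s≡r+1+2l ⟩
      r * (r + suc (2 * (k ∸ r))) + pronic (k ∸ r)    ≡⟨ r*[r+1+2l]+pronic[l]≡pronic[r+l] r (k ∸ r) ⟩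
      pronic (r + (k ∸ r))                            ≡⟨ cong pronic r+l≡k ⟩
      pronic k                                        ∎

  from : ∃[ l ] (l ≤ k × n + pronic l ≡ pronic k) → InDeltaSet n (suc (2 * k))
  from (l , l≤k , gap) = r , r + suc (2 * l) , m≤m+n r _ , r*s≡n , r+l≡k⇒1+2k≡r+[r+1+2l] r l r+l≡k
    where
    r = k ∸ l
    r+l≡k : r + l ≡ k
    r+l≡k = m∸n+n≡m l≤k
    r*s≡n : r * (r + suc (2 * l)) ≡ n
    r*s≡n = +-cancelʳ-≡ (pronic l) _ _ (begin
      r * (r + suc (2 * l)) + pronic l    ≡⟨ r*[r+1+2l]+pronic[l]≡pronic[r+l] r l ⟩
      pronic (r + l)                      ≡⟨ cong pronic r+l≡k ⟩
      pronic k                            ≡⟨ sym gap ⟩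
      n + pronic l                        ∎)

k*k<n⇒pronic-gap⇔ : ∀ {k n} → k * k < n →
  (∃[ l ] (l ≤ k × n + pronic l ≡ pronic k)) ⇔ (∃[ l ] (pronic l ≤ pred k × n ≡ pronic k ∸ pronic l))
k*k<n⇒pronic-gap⇔ {k} {n} k*k<n = mk⇔ to from
  where
  to : ∃[ l ] (l ≤ k × n + pronic l ≡ pronic k) → ∃[ l ] (pronic l ≤ pred k × n ≡ pronic k ∸ pronic l)
  to (l , _ , gap) = l , suc[m]≤n⇒m≤pred[n] (+-cancelˡ-≤ (k * k) _ _ bound) , n≡
    where
    bound : k * k + suc (pronic l) ≤ k * k + k
    bound = begin
      k * k + suc (pronic l)  ≡⟨ +-suc (k * k) (pronic l) ⟩
      suc (k * k) + pronic l  ≤⟨ +-monoˡ-≤ (pronic l) k*k<n ⟩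
      n + pronic l            ≡⟨ gap ⟩
      k * k + k               ∎
      where open ≤-Reasoning
    n≡ : n ≡ pronic k ∸ pronic l
    n≡ = begin
      n                         ≡⟨ sym (m+n∸n≡m n (pronic l)) ⟩
      n + pronic l ∸ pronic l   ≡⟨ cong (_∸ pronic l) gap ⟩
      pronic k ∸ pronic l       ∎
      where open ≡-Reasoning

  from : ∃[ l ] (pronic l ≤ pred k × n ≡ pronic k ∸ pronic l) → ∃[ l ] (l ≤ k × n + pronic l ≡ pronic k)
  from (l , pronic[l]≤k-1 , refl) = l , ≤-trans (m≤n+m l (l * l)) pronic[l]≤k , m∸n+n≡m pronic[l]≤pronic[k]
    where
    pronic[l]≤k : pronic l ≤ k
    pronic[l]≤k = ≤-trans pronic[l]≤k-1 pred[n]≤n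
    pronic[l]≤pronic[k] : pronic l ≤ pronic k
    pronic[l]≤pronic[k] = ≤-trans pronic[l]≤k (m≤n+m k (k * k))

proposition6p7 : (k n : ℕ) → 1 ≤ k → suc (k * k) ≤ n → n ≤ k * k + k →
    (d : ℕ) → IsDelta n d →
    (suc (2 * k) ≤ d)
    × ((d ≡ suc (2 * k)) ⇔ (∃[ l ] (l * l + l ≤ k ∸ 1 × n ≡ (k * k + k) ∸ (l * l + l))))
proposition6p7 k n _ k*k<n _ d δ@(d∈ , _) =
  lower-bound _ d∈ ,
  ⇔-trans (IsDelta-≡⇔attained δ lower-bound)
    (⇔-trans (1+2k∈Δ[n]⇔pronic-gap n k) (k*k<n⇒pronic-gap⇔ k*k<n))
  where
  lower-bound : ∀ m → InDeltaSet n m → suc (2 * k) ≤ m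
  lower-bound _ = k*k<n⇒m∈Δ[n]⇒2k<m k k*k<n
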